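{- For all addressing machines $M,N\in\mathcal{M}$, the following are equivalent: (1) $M\twoheadrightarrow_h N$ and $N$ is in a final state (has no $\to_h$-reduct); (2) $M\Downarrow N$.
   Context: Addressing machines. Fix a countable set $\mathbb{A}$ of addresses and a symbol $\varnothing\notin\mathbb{A}$; put $\mathbb{A}_\varnothing=\mathbb{A}\cup\{\varnothing\}$. A tape is a finite list of elements of $\mathbb{A}$; $a::T$ is the tape with head $a$ and tail $T$, $T@T'$ is concatenation. A program is a finite list of instructions generated by $P::=\mathtt{Load}\ i;P\mid A$, $A::=\mathtt{App}(i,j,k);A\mid C$, $C::=\mathtt{Call}\ i\mid\varepsilon$ ($i,j,k\in\mathbb{N}$). For $r\in\mathbb{N}$, $I\subseteq\{0,\dots,r-1\}$, $I\models^r P$ is the least relation such that: $I\models^r\varepsilon$; $I\models^r\mathtt{Call}\ i$ if $i\in I$; $I\models^r\mathtt{App}(i,j,k);A$ if $i,j\in I$ and either ($k<r$ and $I\cup\{k\}\models^r A$) or ($k\ge r$ and $I\models^r A$); $I\models^r\mathtt{Load}\ i;P$ if either ($i<r$ and $I\cup\{i\}\models^r P$) or ($i\ge r$ and $I\models^r P$). An addressing machine is $M=\langle R_0,\dots,R_{r-1},P,T\rangle$ with registers in $\mathbb{A}_\varnothing$, $P$ valid w.r.t. the registers ($\{i<r\mid R_i\ne\varnothing\}\models^r P$), and a tape $T$; $\mathcal{M}$ is the set of all of them, with components $M.\vec R,M.R_i,M.P,M.T$. $\vec R[R_i:=a]$ replaces $R_i$ by $a$ if $i<r$ and is $\vec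 R$ if $i\ge r$. Fix a bijection $\#:\mathcal{M}\to\mathbb{A}$ with inverse $\#^{ -1}$; $M@T'=\langle M.\vec R,M.P,M.T@T'\rangle$; $a\cdot b=\#(\#^{ -1}(a)@[b])$. Head reduction: $\langle\vec R,\mathtt{Load}\ i;P,a::T\rangle\to_h\langle\vec R[R_i:=a],P,T\rangle$, $\langle\vec R,\mathtt{App}(i,j,k);P,T\rangle\to_h\langle\vec R[R_k:=R_i\cdot R_j],P,T\rangle$, $\langle\vec R,\mathtt{Call}\ i,T\rangle\to_h\#^{ -1}(R_i)@T$; $\twoheadrightarrow_h$ reflexive-transitive closure. Big-step semantics: $M\Downarrow V$ is the least relation closed under: (Stuck) if $M.P=\mathtt{Load}\ i;P'$ and $M.T=[]$ then $M\Downarrow M$; (End) if $M.P=\varepsilon$ then $M\Downarrow M$; (Load) if $M.P=\mathtt{Load}\ i;P'$, $M.T=a::T'$ and $\langle M.\vec R[R_i:=a],P',T'\rangle\Downarrow V$ then $M\Downarrow V$; (App) if $M.P=\mathtt{App}(i,j,k);P'$, $a=M.R_i\cdot M.R_j$ and $\langle M.\vec R[R_k:=a],P',M.T\rangle\Downarrow V$ then $M\Downarrow V$; (Call) if $M.P=\mathtt{Call}\ i$ and $\#^{ -1}(M.R_i)@M.T\Downarrow V$ then $M\Downarrow V$. -}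

module Defs where

open import Level using (0ℓ)
open import Data.Nat using (ℕ; zero; suc; _<_; _≥_)
open import Data.List using (List; []; _∷_; _++_; length; [_])
open import Data.Maybe using (Maybe; just; nothing)
open import Data.Product using (_×_; _,_; ∃)
open import Data.Sum using (_⊎_)
open import Relation.Nullary using (¬_)
open import Relation.Unary using (Pred)
open import Relation.Binary.PropositionalEquality using (_≡_)
open import Relation.Binary.Construct.Closure.ReflexiveTransitive using (Star)

-- Instructions and programs (a program is a list of instructions;
-- the grammar P ::= Load i;P | A, A ::= App(i,j,k);A | C,
-- C ::= Call i | ε is enforced by the validity relation below,
-- which, as in the paper, is defined by cases on P, A and C).

data Instr : Set where
  Load : ℕ → Instr
  App  : ℕ → ℕ → ℕ → Instr
  Call : ℕ → Instr

Program : Set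
Program = List Instr

_∪｛_｝ : Pred ℕ 0ℓ → ℕ → Pred ℕ 0ℓ
(I ∪｛ k ｝) n = I n ⊎ n ≡ k

data _⊨C[_]_ (I : Pred ℕ 0ℓ) (r : ℕ) : Program → Set where
  ε    : I ⊨C[ r ] []
  call : ∀ {i} → I i → I ⊨C[ r ] (Call i ∷ [])

data _⊨A[_]_ (I : Pred ℕ 0ℓ) (r : ℕ) : Program → Set where
  fromC   : ∀ {C} → I ⊨C[ r ] C → I ⊨A[ r ] C
  app-in  : ∀ {i j k A} → I i → I j → k < r → (I ∪｛ k ｝) ⊨A[ r ] A →
            I ⊨A[ r ] (App i j k ∷ A)
  app-out : ∀ {i j k A} → I i → I j → k ≥ r → I ⊨A[ r ] A →
            I ⊨A[ r ] (App i j k ∷ A)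

data _⊨P[_]_ (I : Pred ℕ 0ℓ) (r : ℕ) : Program → Set where
  fromA    : ∀ {A} → I ⊨A[ r ] A → I ⊨P[ r ] A
  load-in  : ∀ {i P} → i < r → (I ∪｛ i ｝) ⊨P[ r ] P → I ⊨P[ r ] (Load i ∷ P)
  load-out : ∀ {i P} → i ≥ r → I ⊨P[ r ] P → I ⊨P[ r ] (Load i ∷ P)

-- Registers: a list R₀,…,R_{r-1} of elements of 𝔸_∅ = Maybe 𝔸
-- (nothing plays the role of ∅).

module _ {A : Set} where

  -- R_i (nothing if i ≥ r; never used out of range on valid machines)
  reg : List (Maybe A) → ℕ → Maybe A
  reg []       _       = nothing
  reg (x ∷ xs) zero    = x
  reg (x ∷ xs) (suc i) = reg xs i

  -- R⃗[R_i := x]; unchanged when i ≥ r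
  _[_≔_] : List (Maybe A) → ℕ → Maybe A → List (Maybe A)
  []       [ _     ≔ x ] = []
  (y ∷ ys) [ zero  ≔ x ] = x ∷ ys
  (y ∷ ys) [ suc i ≔ x ] = y ∷ (ys [ i ≔ x ])

  Filled : List (Maybe A) → Pred ℕ 0ℓ
  Filled R i = ∃ λ a → reg R i ≡ just a

-- Addressing machines over the address set A.  The validity proof is
-- irrelevant, so two machines are equal iff registers, program and tape are.

record Machine (A : Set) : Set where
  constructor mkM
  field
    R : List (Maybe A)
    P : Program
    T : List A
    .valid : Filled R ⊨P[ length R ] P
open Machine public

conf : ∀ {A} → Machine A → List (Maybe A) × Program × List A
conf M = R M , P M , T M

module Semantics {A : Set} (# : Machine A → A) (#⁻¹ : A → Machine A) where

  _＠_ : Machine A → List A → Machine A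
  mkM R₀ P₀ T₀ v ＠ T' = mkM R₀ P₀ (T₀ ++ T') v

  _·_ : A → A → A
  a · b = # (#⁻¹ a ＠ [ b ])

  data _→h_ (M : Machine A) : Machine A → Set where
    load : ∀ {i P' a T' N} → P M ≡ Load i ∷ P' → T M ≡ a ∷ T' →
           conf N ≡ (R M [ i ≔ just a ] , P' , T') → M →h N
    app  : ∀ {i j k P' a b N} → P M ≡ App i j k ∷ P' →
           reg (R M) i ≡ just a → reg (R M) j ≡ just b →
           conf N ≡ (R M [ k ≔ just (a · b) ] , P' , T M) → M →h N
    call : ∀ {i a N} → P M ≡ Call i ∷ [] → reg (R M) i ≡ just a →
           conf N ≡ conf (#⁻¹ a ＠ T M) → M →h N

  _↠h_ : Machine A → Machine A → Set
  _↠h_ = Star _→h_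

  Final : Machine A → Set
  Final M = ∀ N → ¬ (M →h N)

  data _⇓_ : Machine A → Machine A → Set where
    stuck : ∀ {M i P'} → P M ≡ Load i ∷ P' → T M ≡ [] → M ⇓ M
    end   : ∀ {M} → P M ≡ [] → M ⇓ M
    load  : ∀ {M M' V i P' a T'} → P M ≡ Load i ∷ P' → T M ≡ a ∷ T' →
            conf M' ≡ (R M [ i ≔ just a ] , P' , T') → M' ⇓ V → M ⇓ V
    app   : ∀ {M M' V i j k P' a b} → P M ≡ App i j k ∷ P' →
            reg (R M) i ≡ just a → reg (R M) j ≡ just b →
            conf M' ≡ (R M [ k ≔ just (a · b) ] , P' , T M) → M' ⇓ V → M ⇓ V
    call  : ∀ {M V i a} → P M ≡ Call i ∷ [] → reg (R M) i ≡ just a →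
            (#⁻¹ a ＠ T M) ⇓ V → M ⇓ V

{-# OPTIONS --safe #-}
-- The big-step rules Load, App and Call are exactly the three head-reduction
-- steps, and the halting rules Stuck and End describe exactly the final
-- machines: validity of the program guarantees that the registers read by App
-- and Call are filled and that Call is the last instruction, so a machine
-- with no head reduct must have an empty program, or a Load facing an empty
-- tape.
module Submission where

open import Defs
open import Level using (0ℓ)
open import Data.Nat using (ℕ; zero; suc; _<_; _≥_; s≤s)
open import Data.List using (List; []; _∷_; length)
open import Data.Maybe using (Maybe; just; nothing)
open import Data.Product using (_×_; _,_; ∃; proj₁; proj₂; uncurry; <_,_>)
open import Data.Sum using (_⊎_; inj₁; inj₂)
open import Data.Empty using (⊥-elim; ⊥-elim-irr)
open import Function.Base using (_∘_; case_of_)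
open import Function.Bundles using (_⇔_; mk⇔)
open import Function.Definitions using (Injective)
open import Relation.Nullary using (¬_)
open import Relation.Unary using (Pred; _⊆_)
open import Relation.Binary.PropositionalEquality using (_≡_; refl; cong; subst)
open import Relation.Binary.Construct.Closure.ReflexiveTransitive using (ε; _◅_)

∪｛｝-mono : ∀ {I J : Pred ℕ 0ℓ} k → I ⊆ J → (I ∪｛ k ｝) ⊆ (J ∪｛ k ｝)
∪｛｝-mono k I⊆J (inj₁ x) = inj₁ (I⊆J x)
∪｛｝-mono k I⊆J (inj₂ x) = inj₂ x

⊨C-mono : ∀ {I J r C} → I ⊆ J → I ⊨C[ r ] C → J ⊨C[ r ] C
⊨C-mono I⊆J ε        = ε
⊨C-mono I⊆J (call x) = call (I⊆J x)

⊨A-mono : ∀ {I J r A} → I ⊆ J → I ⊨A[ r ] A → J ⊨A[ r ] A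
⊨A-mono I⊆J (fromC v)         = fromC (⊨C-mono I⊆J v)
⊨A-mono {I} {J} I⊆J (app-in {k = k} x y k< v) =
  app-in (I⊆J x) (I⊆J y) k< (⊨A-mono (∪｛｝-mono {I} {J} k I⊆J) v)
⊨A-mono I⊆J (app-out x y k≥ v) = app-out (I⊆J x) (I⊆J y) k≥ (⊨A-mono I⊆J v)

⊨P-mono : ∀ {I J r P} → I ⊆ J → I ⊨P[ r ] P → J ⊨P[ r ] P
⊨P-mono I⊆J (fromA v)      = fromA (⊨A-mono I⊆J v)
⊨P-mono {I} {J} I⊆J (load-in {i = i} i< v) =
  load-in i< (⊨P-mono (∪｛｝-mono {I} {J} i I⊆J) v)
⊨P-mono I⊆J (load-out i≥ v) = load-out i≥ (⊨P-mono I⊆J v)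

module _ {A : Set} where

  length-[≔] : ∀ (R : List (Maybe A)) i x → length (R [ i ≔ x ]) ≡ length R
  length-[≔] []      i       x = refl
  length-[≔] (y ∷ R) zero    x = refl
  length-[≔] (y ∷ R) (suc i) x = cong suc (length-[≔] R i x)

  [≔]-out-of-range : ∀ (R : List (Maybe A)) i x → i ≥ length R → R [ i ≔ x ] ≡ R
  [≔]-out-of-range []      i       x _         = refl
  [≔]-out-of-range (y ∷ R) (suc i) x (s≤s i≥) = cong (y ∷_) ([≔]-out-of-range R i x i≥)

  Filled-[≔] : ∀ (R : List (Maybe A)) i a → i < length R →
               (Filled R ∪｛ i ｝) ⊆ Filled (R [ i ≔ just a ])
  Filled-[≔] (y ∷ R) zero    a _        {zero}  _          = a , refl
  Filled-[≔] (y ∷ R) zero    a _        {suc n} (inj₁ x)   = x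
  Filled-[≔] (y ∷ R) (suc i) a _        {zero}  (inj₁ x)   = x
  Filled-[≔] (y ∷ R) (suc i) a (s≤s i<) {suc n} (inj₁ x)   = Filled-[≔] R i a i< (inj₁ x)
  Filled-[≔] (y ∷ R) (suc i) a (s≤s i<) {suc n} (inj₂ refl) = Filled-[≔] R i a i< (inj₂ refl)

  nothing⇒¬just : ∀ {x : Maybe A} → x ≡ nothing → ¬ ∃ (λ a → x ≡ just a)
  nothing⇒¬just refl (_ , ())

  conf-injective : ∀ {M N : Machine A} → conf M ≡ conf N → M ≡ N
  conf-injective {mkM _ _ _ _} {mkM _ _ _ _} refl = refl

  Load-valid : ∀ (R : List (Maybe A)) {i P} a → Filled R ⊨P[ length R ] (Load i ∷ P) →
               Filled (R [ i ≔ just a ]) ⊨P[ length (R [ i ≔ just a ]) ] P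
  Load-valid R a (fromA (fromC ()))
  Load-valid R {i} a (load-in i< v) rewrite length-[≔] R i (just a) =
    ⊨P-mono (Filled-[≔] R i a i<) v
  Load-valid R {i} a (load-out i≥ v) rewrite [≔]-out-of-range R i (just a) i≥ = v

  App-valid : ∀ (R : List (Maybe A)) {i j k P} a → Filled R ⊨P[ length R ] (App i j k ∷ P) →
              Filled (R [ k ≔ just a ]) ⊨P[ length (R [ k ≔ just a ]) ] P
  App-valid R a (fromA (fromC ()))
  App-valid R {k = k} a (fromA (app-in _ _ k< v)) rewrite length-[≔] R k (just a) =
    fromA (⊨A-mono (Filled-[≔] R k a k<) v)
  App-valid R {k = k} a (fromA (app-out _ _ k≥ v)) rewrite [≔]-out-of-range R k (just a) k≥ =
    fromA v

  App-operands-filled : ∀ (R : List (Maybe A)) {i j k P} →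
                        Filled R ⊨P[ length R ] (App i j k ∷ P) → Filled R i × Filled R j
  App-operands-filled R (fromA (fromC ()))
  App-operands-filled R (fromA (app-in x y _ _))  = x , y
  App-operands-filled R (fromA (app-out x y _ _)) = x , y

  Call-valid : ∀ (R : List (Maybe A)) {i P} →
               Filled R ⊨P[ length R ] (Call i ∷ P) → Filled R i × P ≡ []
  Call-valid R (fromA (fromC (call x))) = x , refl

module _ {A : Set} (# : Machine A → A) (#⁻¹ : A → Machine A) where
  open Semantics # #⁻¹

  ended-Final : ∀ {M} → P M ≡ [] → Final M
  ended-Final refl _ (load () _ _)
  ended-Final refl _ (app () _ _ _)
  ended-Final refl _ (call () _ _)

  stuck-Final : ∀ {M i P'} → P M ≡ Load i ∷ P' → T M ≡ [] → Final M
  stuck-Final refl refl _ (load refl () _)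
  stuck-Final refl _    _ (app () _ _ _)
  stuck-Final refl _    _ (call () _ _)

  progress : (M : Machine A) → M ⇓ M ⊎ ∃ (M →h_)
  progress (mkM R [] T v)                = inj₁ (end refl)
  progress (mkM R (Load i ∷ P) [] v)      = inj₁ (stuck refl refl)
  progress (mkM R (Load i ∷ P) (a ∷ T) v) = inj₂ (mkM _ P T (Load-valid R a v) , load refl refl refl)
  progress (mkM R (App i j k ∷ P) T v) with reg R i in ei | reg R j in ej
  ... | just a  | just b  = inj₂ (mkM _ P T (App-valid R (a · b) v) , app refl ei ej refl)
  ... | nothing | _       = ⊥-elim-irr (nothing⇒¬just ei (proj₁ (App-operands-filled R v)))
  ... | just _  | nothing = ⊥-elim-irr (nothing⇒¬just ej (proj₂ (App-operands-filled R v)))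
  progress (mkM R (Call i ∷ []) T v) with reg R i in ei
  ... | just a  = inj₂ (#⁻¹ a ＠ T , call refl ei refl)
  ... | nothing = ⊥-elim-irr (nothing⇒¬just ei (proj₁ (Call-valid R v)))
  progress (mkM R (Call i ∷ _ ∷ _) T v) = ⊥-elim-irr (case proj₂ (Call-valid R v) of λ ())

  Final⇒⇓ : ∀ {N} → Final N → N ⇓ N
  Final⇒⇓ {N} final with progress N
  ... | inj₁ N⇓N        = N⇓N
  ... | inj₂ (N' , N→N') = ⊥-elim (final N' N→N')

  ⇓⇒Final : ∀ {M N} → M ⇓ N → Final N
  ⇓⇒Final (stuck p t)         = stuck-Final p t
  ⇓⇒Final (end p)             = ended-Final p
  ⇓⇒Final (load _ _ _ M'⇓N)   = ⇓⇒Final M'⇓N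
  ⇓⇒Final (app _ _ _ _ M'⇓N)  = ⇓⇒Final M'⇓N
  ⇓⇒Final (call _ _ M'⇓N)     = ⇓⇒Final M'⇓N

  ⇓⇒↠h : ∀ {M N} → M ⇓ N → M ↠h N
  ⇓⇒↠h (stuck _ _)           = ε
  ⇓⇒↠h (end _)               = ε
  ⇓⇒↠h (load p t c M'⇓N)     = load p t c ◅ ⇓⇒↠h M'⇓N
  ⇓⇒↠h (app p x y c M'⇓N)    = app p x y c ◅ ⇓⇒↠h M'⇓N
  ⇓⇒↠h (call p x M'⇓N)       = call p x refl ◅ ⇓⇒↠h M'⇓N

  →h-⇓ : ∀ {M M' V} → M →h M' → M' ⇓ V → M ⇓ V
  →h-⇓ (load p t c)  = load p t c
  →h-⇓ (app p x y c) = app p x y c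
  →h-⇓ (call p x c)  = call p x ∘ subst (_⇓ _) (conf-injective c)

  ↠h⇒⇓ : ∀ {M N} → M ↠h N → Final N → M ⇓ N
  ↠h⇒⇓ ε              final = Final⇒⇓ final
  ↠h⇒⇓ (M→M' ◅ M'↠N) final = →h-⇓ M→M' (↠h⇒⇓ M'↠N final)

proposition2p16 : (A : Set) (enc : A → ℕ) → Injective _≡_ _≡_ enc →
                  (# : Machine A → A) (#⁻¹ : A → Machine A) →
                  (∀ M → #⁻¹ (# M) ≡ M) → (∀ a → # (#⁻¹ a) ≡ a) →
                  (M N : Machine A) →
                  ((Semantics._↠h_ # #⁻¹ M N × Semantics.Final # #⁻¹ N)
                    ⇔ Semantics._⇓_ # #⁻¹ M N)
proposition2p16 A _ _ # #⁻¹ _ _ M N =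
  mk⇔ (uncurry (↠h⇒⇓ # #⁻¹)) < ⇓⇒↠h # #⁻¹ , ⇓⇒Final # #⁻¹ >
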